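{- For each basic Boolean formula $\phi$, there exists an $X\in\mathcal{IS}^0_{br}$ in which the basic instruction $\mathtt{out}.\mathtt{set{:}F}$ does not occur such that $X$ computes the Boolean function induced by $\phi$ and $|X|$ is linear in the size of $\phi$ (bounded by a linear function of the size of $\phi$ with constants independent of $\phi$).
   Context: Let $\mathbb B=\{\mathsf T,\mathsf F\}$. There are Boolean registers named $\mathtt{in}{:}i$ ($i\ge1$), $\mathtt{aux}{:}i$ ($i\ge1$) and $\mathtt{out}$, processing methods $\mathtt{set{:}T}$ (content becomes $\mathsf T$, reply $\mathsf T$), $\mathtt{set{:}F}$ (content becomes $\mathsf F$, reply $\mathsf F$), $\mathtt{get}$ (no change, reply is the content). Basic instructions are $f.m$ ($f$ register name, $m$ method). Primitive instructions: for each basic instruction $a$, the plain instruction $a$, positive test $+a$, negative test $-a$; forward jumps $\#l$ ($l\in\mathbb N$); termination $!$. An instruction sequence is a finite non-empty sequence $X=u_1;\dots;u_k$ of primitive instructions, $|X|=k$. Execution starts at $u_1$: $a$ executes $a$ and proceeds with the next instruction; $+a$ executes $a$ and proceeds with the next instruction if the reply is $\mathsf T$, otherwise skips the next instruction and proceeds with the one after; $-a$ likewise with reply roles reversed; $\#l$ proceeds with the $l$-th next instruction ($\#0$ causes inaction); $!$ terminates; if there is no instruction to proceed with, inaction occurs. $\mathcal{IS}_{br}$ is the set of instruction sequences whose basic instructions are all of the forms $\mathtt{in}{:}i.\mathtt{get}$, $\mathtt{aux}{:}i.\mathtt{get}$, $\mathtt{aux}{:}i.\mathtt{set{:}}b$,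 $\mathtt{out}.\mathtt{set{:}}b$ ($b\in\mathbb B$); $\mathcal{IS}^0_{br}$ is the set of $X\in\mathcal{IS}_{br}$ in which no instruction on an auxiliary register occurs. $X$ computes $f:\mathbb B^n\to\mathbb B$ if for all $b_1,\dots,b_n$, executing $X$ with $\mathtt{in}{:}i$ initially $b_i$ ($i\le n$) and all auxiliary registers and $\mathtt{out}$ initially $\mathsf F$, execution never executes an instruction on $\mathtt{in}{:}i$ with $i>n$, ends by executing $!$, and leaves $f(b_1,\dots,b_n)$ in $\mathtt{out}$. A basic Boolean formula is a Boolean formula in which no connectives other than $\neg$, $\vee$, $\wedge$ occur. For a Boolean formula $\phi$ containing the variables $v_1,\dots,v_n$, the Boolean function induced by $\phi$ is $f:\mathbb B^n\to\mathbb B$ with $f(b_1,\dots,b_n)=\mathsf T$ iff $\phi$ is satisfied by the assignment $v_i\mapsto b_i$. -}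

module Defs where

open import Data.Bool using (Bool; true; false; not; _∧_; _∨_; if_then_else_)
open import Data.Nat using (ℕ; zero; suc; _+_; _<_; _<?_)
open import Data.Fin using (Fin)
open import Data.Vec using (Vec; lookup)
open import Data.List using (List; []; _∷_)
open import Data.List.Relation.Unary.All using (All)
open import Data.Maybe using (Maybe; just; nothing)
open import Data.Empty using (⊥)
open import Data.Unit using (⊤)
open import Relation.Binary.PropositionalEquality using (_≡_; _≢_)
open import Relation.Nullary using (yes; no)

-- Basic Boolean formulas over variables v_1..v_n (variable v_{i+1} is
-- represented by  var i  with  i : Fin n), with constants T and F.

data Form (n : ℕ) : Set where
  var  : Fin n → Form n
  tt   : Form n
  ff   : Form n
  ¬f_  : Form n → Form n
  _∨f_ : Form n → Form n → Form n
  _∧f_ : Form n → Form n → Form n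

size : ∀ {n} → Form n → ℕ
size (var _)  = 1
size tt       = 1
size ff       = 1
size (¬f φ)   = suc (size φ)
size (φ ∨f ψ) = suc (size φ + size ψ)
size (φ ∧f ψ) = suc (size φ + size ψ)

data Occurs {n : ℕ} (i : Fin n) : Form n → Set where
  here  : Occurs i (var i)
  neg   : ∀ {φ} → Occurs i φ → Occurs i (¬f φ)
  orl   : ∀ {φ ψ} → Occurs i φ → Occurs i (φ ∨f ψ)
  orr   : ∀ {φ ψ} → Occurs i ψ → Occurs i (φ ∨f ψ)
  andl  : ∀ {φ ψ} → Occurs i φ → Occurs i (φ ∧f ψ)
  andr  : ∀ {φ ψ} → Occurs i ψ → Occurs i (φ ∧f ψ)

eval : ∀ {n} → Vec Bool n → Form n → Bool
eval ρ (var i)  = lookup ρ i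
eval ρ tt       = true
eval ρ ff       = false
eval ρ (¬f φ)   = not (eval ρ φ)
eval ρ (φ ∨f ψ) = eval ρ φ ∨ eval ρ ψ
eval ρ (φ ∧f ψ) = eval ρ φ ∧ eval ρ ψ

induced : ∀ {n} → Form n → Vec Bool n → Bool
induced φ ρ = eval ρ φ

-- Instruction sequences of IS_br.
-- Register  in:(i+1)  is written  inGet i ;  aux:(i+1)  uses index i.

data BasicInstr : Set where
  inGet  : ℕ → BasicInstr
  auxGet : ℕ → BasicInstr
  auxSet : ℕ → Bool → BasicInstr
  outSet : Bool → BasicInstr

data Instr : Set where
  plain : BasicInstr → Instr
  ptest : BasicInstr → Instr
  ntest : BasicInstr → Instr
  jump  : ℕ → Instr
  halt  : Instr

InstrSeq : Set
InstrSeq = List Instr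

basicOf : Instr → Maybe BasicInstr
basicOf (plain a) = just a
basicOf (ptest a) = just a
basicOf (ntest a) = just a
basicOf (jump _)  = nothing
basicOf halt      = nothing

IsAux : BasicInstr → Set
IsAux (inGet _)    = ⊥
IsAux (auxGet _)   = ⊤
IsAux (auxSet _ _) = ⊤
IsAux (outSet _)   = ⊥

NoAuxInstr : Instr → Set
NoAuxInstr u with basicOf u
... | just a  = IsAux a → ⊥
... | nothing = ⊤

-- X ∈ IS^0_br (given X ∈ IS_br, which holds by construction of Instr)
InIS0 : InstrSeq → Set
InIS0 X = All NoAuxInstr X

NoOutSetFInstr : Instr → Set
NoOutSetFInstr u = basicOf u ≢ just (outSet false)

NoOutSetF : InstrSeq → Set
NoOutSetF X = All NoOutSetFInstr X

record State : Set where
  constructor st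
  field
    pc  : ℕ            -- 0-based position of the next instruction
    aux : ℕ → Bool
    out : Bool

data Outcome : Set where
  terminated : Bool → Outcome
  inaction   : Outcome
  badInput   : Outcome

data StepResult : Set where
  done : Outcome → StepResult
  next : State → StepResult

fetch : InstrSeq → ℕ → Maybe Instr
fetch []       _       = nothing
fetch (u ∷ X)  zero    = just u
fetch (u ∷ X)  (suc k) = fetch X k

update : (ℕ → Bool) → ℕ → Bool → ℕ → Bool
update f i b j with i Data.Nat.≟ j
... | yes _ = b
... | no  _ = f j

data ExecResult : Set where
  illegal : ExecResult
  ok      : Bool → (ℕ → Bool) → Bool → ExecResult

execBasic : ∀ {n} → Vec Bool n → BasicInstr → (ℕ → Bool) → Bool → ExecResult
execBasic {n} ρ (inGet i) a o with i <? n
... | yes i<n = ok (lookup ρ (Data.Fin.fromℕ< i<n)) a o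
... | no  _   = illegal
execBasic ρ (auxGet i)   a o = ok (a i) a o
execBasic ρ (auxSet i b) a o = ok b (update a i b) o
execBasic ρ (outSet b)   a o = ok b a b

step : ∀ {n} → Vec Bool n → InstrSeq → State → StepResult
step ρ X (st p a o) with fetch X p
... | nothing = done inaction
... | just halt = done (terminated o)
... | just (jump zero) = done inaction
... | just (jump (suc l)) = next (st (p + suc l) a o)
... | just (plain b) with execBasic ρ b a o
...   | illegal = done badInput
...   | ok _ a' o' = next (st (suc p) a' o')
step ρ X (st p a o) | just (ptest b) with execBasic ρ b a o
...   | illegal = done badInput
...   | ok r a' o' = next (st (if r then suc p else suc (suc p)) a' o')
step ρ X (st p a o) | just (ntest b) with execBasic ρ b a o
...   | illegal = done badInput
...   | ok r a' o' = next (st (if r then suc (suc p) else suc p) a' o')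

-- run for at most k steps; nothing = not yet finished
run : ∀ {n} → ℕ → Vec Bool n → InstrSeq → State → Maybe Outcome
run zero    ρ X s = nothing
run (suc k) ρ X s with step ρ X s
... | done r  = just r
... | next s' = run k ρ X s'

initial : State
initial = st 0 (λ _ → false) false

Computes : (n : ℕ) → InstrSeq → (Vec Bool n → Bool) → Set
Computes n X f =
  (ρ : Vec Bool n) → Data.Product.Σ ℕ (λ k → run k ρ X initial ≡ just (terminated (f ρ)))
  where import Data.Product

-- A formula compiles to a segment of jumps and input tests with two exits: execution entering
-- the segment leaves it at the position just after it if the formula holds and one position
-- further if it fails.  Negation, disjunction and conjunction only need two jumps of glue
-- between the segments of their operands, so the segment has length at most 2·size φ.
-- Appending  out.set:T ; !  makes the true exit set out and terminate and the false exit
-- terminate with out still F.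
module Submission where

open import Defs
open import Data.Nat using (ℕ; _≤_; _+_; _*_; suc; s≤s; z≤n; _<?_)
open import Data.Nat.Properties using (+-suc; +-assoc; +-comm; +-identityʳ; +-mono-≤; ≤-refl; ≤-reflexive; ≤-trans; module ≤-Reasoning)
open import Data.Nat.Tactic.RingSolver using (solve-∀)
open import Data.Bool using (Bool; true; false; not; _∨_; _∧_; if_then_else_)
open import Data.Fin using (Fin; toℕ)
open import Data.Fin.Properties using (toℕ<n; fromℕ<-toℕ)
open import Data.Vec using (Vec; lookup)
open import Data.List using (List; []; _∷_; _++_; length)
open import Data.List.Properties using (length-++; ++-conicalʳ)
open import Data.List.Relation.Unary.All using (All; []; _∷_)
open import Data.List.Relation.Unary.All.Properties using (++⁺)
open import Data.Maybe using (just)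
open import Data.Product using (Σ; _×_; _,_)
open import Data.Unit using (tt)
open import Data.Empty using (⊥-elim)
open import Relation.Binary.Construct.Closure.ReflexiveTransitive using (Star; ε; _◅_; _◅◅_)
open import Relation.Binary.PropositionalEquality using (_≡_; _≢_; refl; sym; trans; cong; subst)
open import Relation.Nullary using (yes; no)

compile : ∀ {n} → Form n → InstrSeq
compile (var i)  = ptest (inGet (toℕ i)) ∷ []
compile tt       = jump 1 ∷ []
compile ff       = jump 2 ∷ []
compile (¬f φ)   = compile φ ++ jump 3 ∷ jump 1 ∷ []
compile (φ ∨f ψ) = compile φ ++ jump (2 + length (compile ψ)) ∷ jump 1 ∷ compile ψ
compile (φ ∧f ψ) = compile φ ++ jump 2 ∷ jump (2 + length (compile ψ)) ∷ compile ψ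

program : ∀ {n} → Form n → InstrSeq
program φ = compile φ ++ plain (outSet true) ∷ halt ∷ []

All-compile : ∀ {n} {P : Instr → Set} → (∀ l → P (jump l)) → (∀ i → P (ptest (inGet i))) →
              (φ : Form n) → All P (compile φ)
All-compile Pj Pi (var i)  = Pi (toℕ i) ∷ []
All-compile Pj Pi tt       = Pj 1 ∷ []
All-compile Pj Pi ff       = Pj 2 ∷ []
All-compile Pj Pi (¬f φ)   = ++⁺ (All-compile Pj Pi φ) (Pj 3 ∷ Pj 1 ∷ [])
All-compile Pj Pi (φ ∨f ψ) = ++⁺ (All-compile Pj Pi φ) (Pj _ ∷ Pj 1 ∷ All-compile Pj Pi ψ)
All-compile Pj Pi (φ ∧f ψ) = ++⁺ (All-compile Pj Pi φ) (Pj 2 ∷ Pj _ ∷ All-compile Pj Pi ψ)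

program-InIS0 : ∀ {n} (φ : Form n) → InIS0 (program φ)
program-InIS0 φ = ++⁺ (All-compile (λ _ → tt) (λ _ ()) φ) ((λ ()) ∷ tt ∷ [])

program-NoOutSetF : ∀ {n} (φ : Form n) → NoOutSetF (program φ)
program-NoOutSetF φ = ++⁺ (All-compile (λ _ ()) (λ _ ()) φ) ((λ ()) ∷ (λ ()) ∷ [])

program-nonempty : ∀ {n} (φ : Form n) → program φ ≢ []
program-nonempty φ eq with ++-conicalʳ (compile φ) _ eq
... | ()

length-glue-≤ : ∀ {A : Set} (C D : List A) {u v : A} (s t : ℕ) →
                length C ≤ 2 * s → length D ≤ 2 * t → length (C ++ u ∷ v ∷ D) ≤ 2 * suc (s + t)
length-glue-≤ C D {u} {v} s t C≤ D≤ = begin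
  length (C ++ u ∷ v ∷ D)   ≡⟨ length-++ C ⟩
  length C + (2 + length D) ≤⟨ +-mono-≤ C≤ (s≤s (s≤s D≤)) ⟩
  2 * s + (2 + 2 * t)       ≡⟨ regroup s t ⟩
  2 * suc (s + t)           ∎
  where
  open ≤-Reasoning
  regroup : ∀ s t → 2 * s + (2 + 2 * t) ≡ 2 * suc (s + t)
  regroup = solve-∀

length-compile-≤ : ∀ {n} (φ : Form n) → length (compile φ) ≤ 2 * size φ
length-compile-≤ (var i)  = s≤s z≤n
length-compile-≤ tt       = s≤s z≤n
length-compile-≤ ff       = s≤s z≤n
length-compile-≤ (¬f φ)   = subst (λ s → length (compile (¬f φ)) ≤ 2 * suc s) (+-identityʳ (size φ))
  (length-glue-≤ (compile φ) [] (size φ) 0 (length-compile-≤ φ) z≤n)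
length-compile-≤ (φ ∨f ψ) =
  length-glue-≤ (compile φ) (compile ψ) (size φ) (size ψ) (length-compile-≤ φ) (length-compile-≤ ψ)
length-compile-≤ (φ ∧f ψ) =
  length-glue-≤ (compile φ) (compile ψ) (size φ) (size ψ) (length-compile-≤ φ) (length-compile-≤ ψ)

record At (X : InstrSeq) (p : ℕ) (C : InstrSeq) : Set where
  constructor at
  field fetch-at : ∀ k {u} → fetch C k ≡ just u → fetch X (p + k) ≡ just u
open At

fetch-++ˡ : ∀ C D k {u} → fetch C k ≡ just u → fetch (C ++ D) k ≡ just u
fetch-++ˡ (v ∷ C) D 0       e = e
fetch-++ˡ (v ∷ C) D (suc k) e = fetch-++ˡ C D k e

fetch-++ʳ : ∀ C D k → fetch (C ++ D) (length C + k) ≡ fetch D k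
fetch-++ʳ []      D k = refl
fetch-++ʳ (v ∷ C) D k = fetch-++ʳ C D k

At-refl : ∀ X → At X 0 X
At-refl X = at λ k e → e

At-++ˡ : ∀ {X p} C D → At X p (C ++ D) → At X p C
At-++ˡ C D A = at λ k e → fetch-at A k (fetch-++ˡ C D k e)

At-++ʳ : ∀ {X p} C D → At X p (C ++ D) → At X (p + length C) D
At-++ʳ {X} {p} C D A = at λ k {u} e → subst (λ r → fetch X r ≡ just u) (sym (+-assoc p (length C) k))
  (fetch-at A (length C + k) (trans (fetch-++ʳ C D k) e))

At-suc : ∀ {X p u C} → At X p (u ∷ C) → At X (suc p) C
At-suc {X} {p} A = at λ k {u} e → subst (λ r → fetch X r ≡ just u) (+-suc p k) (fetch-at A (suc k) e)

At-head : ∀ {X p u C} → At X p (u ∷ C) → fetch X p ≡ just u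
At-head {X} {p} A = subst (λ r → fetch X r ≡ just _) (+-identityʳ p) (fetch-at A 0 refl)

At-glue : ∀ {X p u v} C D → At X p (C ++ u ∷ v ∷ D) →
          At X p C × At X (p + length C) (u ∷ v ∷ []) × At X (p + length C + 2) D
At-glue {X} {p} {u} {v} C D A = At-++ˡ C _ A , At-++ˡ (u ∷ v ∷ []) D rest , At-++ʳ (u ∷ v ∷ []) D rest
  where
  rest : At X (p + length C) (u ∷ v ∷ D)
  rest = At-++ʳ C _ A

+-length-++ : ∀ p (C D : InstrSeq) → p + length (C ++ D) ≡ p + length C + length D
+-length-++ p C D = trans (cong (p +_) (length-++ C)) (sym (+-assoc p (length C) (length D)))

exit : ℕ → Bool → ℕ
exit q b = if b then q else suc q

module Execution {n : ℕ} (ρ : Vec Bool n) (X : InstrSeq) where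

  _⟶_ : State → State → Set
  s ⟶ s′ = step ρ X s ≡ next s′

  _⟶*_ : State → State → Set
  _⟶*_ = Star _⟶_

  run-suc : ∀ {s s′} k → s ⟶ s′ → run (suc k) ρ X s ≡ run k ρ X s′
  run-suc {st p a o} k e rewrite e = refl

  run-one : ∀ {s r} → step ρ X s ≡ done r → run 1 ρ X s ≡ just r
  run-one {st p a o} e rewrite e = refl

  run-⟶* : ∀ {s s′ r} → s ⟶* s′ → step ρ X s′ ≡ done r → Σ ℕ λ k → run k ρ X s ≡ just r
  run-⟶* ε         e = 1 , run-one e
  run-⟶* (s⟶ ◅ s⟶*) e with run-⟶* s⟶* e
  ... | k , runs = suc k , trans (run-suc k s⟶) runs

  retarget : ∀ {s p q a o} → p ≡ q → s ⟶* st p a o → s ⟶* st q a o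
  retarget refl steps = steps

  jump-⟶ : ∀ {p l a o} → fetch X p ≡ just (jump (suc l)) → st p a o ⟶ st (p + suc l) a o
  jump-⟶ e rewrite e = refl

  outSet-⟶ : ∀ {p b a o} → fetch X p ≡ just (plain (outSet b)) → st p a o ⟶ st (suc p) a b
  outSet-⟶ e rewrite e = refl

  halt-done : ∀ {p a o} → fetch X p ≡ just halt → step ρ X (st p a o) ≡ done (terminated o)
  halt-done e rewrite e = refl

  test-input-⟶ : ∀ {p a o} (j : Fin n) → fetch X p ≡ just (ptest (inGet (toℕ j))) →
                 st p a o ⟶ st (exit (suc p) (lookup ρ j)) a o
  test-input-⟶ j e rewrite e with toℕ j <? n
  ... | yes j<n rewrite fromℕ<-toℕ j j<n = refl
  ... | no  j≮n = ⊥-elim (j≮n (toℕ<n j))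

  Exits : ℕ → ℕ → Bool → Set
  Exits p q b = ∀ {a o} → st p a o ⟶* st (exit q b) a o

  Exits-var : ∀ {p} (j : Fin n) → At X p (ptest (inGet (toℕ j)) ∷ []) → Exits p (p + 1) (lookup ρ j)
  Exits-var {p} j A = retarget (cong (λ r → exit r (lookup ρ j)) (+-comm 1 p)) (test-input-⟶ j (At-head A) ◅ ε)

  Exits-true : ∀ {p} → At X p (jump 1 ∷ []) → Exits p (p + 1) true
  Exits-true A = jump-⟶ (At-head A) ◅ ε

  Exits-false : ∀ {p} → At X p (jump 2 ∷ []) → Exits p (p + 1) false
  Exits-false {p} A = retarget (+-suc p 1) (jump-⟶ (At-head A) ◅ ε)

  Exits-not : ∀ {p q b} → At X q (jump 3 ∷ jump 1 ∷ []) → Exits p q b → Exits p (q + 2) (not b)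
  Exits-not {q = q} {true}  glue E = E ◅◅ retarget (+-suc q 2) (jump-⟶ (At-head glue) ◅ ε)
  Exits-not {q = q} {false} glue E = E ◅◅ retarget (sym (+-suc q 1)) (jump-⟶ (At-head (At-suc glue)) ◅ ε)

  Exits-or : ∀ {p q m b c} → At X q (jump (2 + m) ∷ jump 1 ∷ []) →
             Exits p q b → Exits (q + 2) (q + 2 + m) c → Exits p (q + (2 + m)) (b ∨ c)
  Exits-or {b = true} glue E₁ E₂ = E₁ ◅◅ jump-⟶ (At-head glue) ◅ ε
  Exits-or {q = q} {m} {false} {c} glue E₁ E₂ =
    E₁ ◅◅ retarget (sym (+-suc q 1)) (jump-⟶ (At-head (At-suc glue)) ◅ ε)
       ◅◅ retarget (cong (λ r → exit r c) (+-assoc q 2 m)) E₂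

  Exits-and : ∀ {p q m b c} → At X q (jump 2 ∷ jump (2 + m) ∷ []) →
              Exits p q b → Exits (q + 2) (q + 2 + m) c → Exits p (q + (2 + m)) (b ∧ c)
  Exits-and {q = q} {m} {true} {c} glue E₁ E₂ =
    E₁ ◅◅ jump-⟶ (At-head glue) ◅ ε ◅◅ retarget (cong (λ r → exit r c) (+-assoc q 2 m)) E₂
  Exits-and {b = false} glue E₁ E₂ = E₁ ◅◅ jump-⟶ (At-head (At-suc glue)) ◅ ε

  Exits-++ : ∀ {p b} C D → Exits p (p + length C + length D) b → Exits p (p + length (C ++ D)) b
  Exits-++ {p} {b} C D = subst (λ q → Exits p q b) (sym (+-length-++ p C D))

  compile-Exits : ∀ {p} (φ : Form n) → At X p (compile φ) → Exits p (p + length (compile φ)) (eval ρ φ)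
  compile-Exits (var j)  A = Exits-var j A
  compile-Exits tt       A = Exits-true A
  compile-Exits ff       A = Exits-false A
  compile-Exits (¬f φ)   A =
    Exits-++ (compile φ) _ (Exits-not (At-++ʳ (compile φ) _ A) (compile-Exits φ (At-++ˡ (compile φ) _ A)))
  compile-Exits (φ ∨f ψ) A with At-glue (compile φ) (compile ψ) A
  ... | Aφ , glue , Aψ = Exits-++ (compile φ) _ (Exits-or glue (compile-Exits φ Aφ) (compile-Exits ψ Aψ))
  compile-Exits (φ ∧f ψ) A with At-glue (compile φ) (compile ψ) A
  ... | Aφ , glue , Aψ = Exits-++ (compile φ) _ (Exits-and glue (compile-Exits φ Aφ) (compile-Exits ψ Aψ))

  program-terminates : ∀ {p q b a} → At X q (plain (outSet true) ∷ halt ∷ []) → Exits p q b →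
                       Σ ℕ λ k → run k ρ X (st p a false) ≡ just (terminated b)
  program-terminates {b = true}  final E =
    run-⟶* (E ◅◅ outSet-⟶ (At-head final) ◅ ε) (halt-done (At-head (At-suc final)))
  program-terminates {b = false} final E = run-⟶* E (halt-done (At-head (At-suc final)))

program-computes : ∀ {n} (φ : Form n) → Computes n (program φ) (induced φ)
program-computes φ ρ =
  program-terminates (At-++ʳ (compile φ) _ whole) (compile-Exits φ (At-++ˡ (compile φ) _ whole))
  where
  open Execution ρ (program φ)
  whole : At (program φ) 0 (program φ)
  whole = At-refl (program φ)

length-program-≤ : ∀ {n} (φ : Form n) → length (program φ) ≤ 2 * size φ + 2
length-program-≤ φ = ≤-trans (≤-reflexive (length-++ (compile φ))) (+-mono-≤ (length-compile-≤ φ) ≤-refl)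

proposition4 : Σ ℕ λ c → Σ ℕ λ d →
    (n : ℕ) (φ : Form n) → (∀ i → Occurs i φ) →
      Σ InstrSeq λ X →
        X ≢ [] × InIS0 X × NoOutSetF X × Computes n X (induced φ) ×
        length X ≤ c * size φ + d
proposition4 = 2 , 2 , λ n φ _ → program φ ,
  program-nonempty φ , program-InIS0 φ , program-NoOutSetF φ , program-computes φ , length-program-≤ φ
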